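{- Let $k$, $\mathfrak t$, $w$ be positive integers and $z$ a nonnegative integer, and let $\ell=\lfloor\log_2 k\rfloor+1$. Then there exists a covering system $\mathcal C=\{r_j\pmod{m_j}:1\le j\le\tau\}$ together with distinct primes $p_1,\dots,p_\tau$, $p_j\mid 2^{m_j}-1$, such that $k_2^{(z;t)}\equiv -2^{ -r_j}\pmod{p_j}$ for all $1\le j\le\tau$ and all positive integers $t\equiv\mathfrak t\pmod w$ (i.e. $\mathcal C$ produces $k_2^{(z;t)}$ as a Sierpiński number for all such $t$ via the covering system method) if and only if there exists a covering system $\mathcal C'=\{r'_j\pmod{m'_j}:1\le j\le\tau'\}$ together with distinct primes $p'_1,\dots,p'_{\tau'}$, $p'_j\mid 2^{m'_j}-1$, such that $k_2^{(z;t')}\equiv 2^{ -r'_j}\pmod{p'_j}$ for all $1\le j\le\tau'$ and all positive integers $t'\equiv-\mathfrak t\pmod w$ (i.e. $\mathcal C'$ produces $k_2^{(z;t')}$ as a Riesel number for all such $t'$ via the covering system method).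
   Context: A covering system of the integers is a finite collection of congruences $r_j \pmod{m_j}$ such that every integer satisfies at least one of them. $2^{ -r}\pmod p$ denotes the inverse of $2^r$ modulo the odd prime $p$. For integers $k\ge1$, $t\ge1$, $z\ge0$, the $2$-repstring is $k_2^{(z;t)}=k\,(2^{(z+\ell)t}-1)/(2^{z+\ell}-1)$ with $\ell=\lfloor\log_2 k\rfloor+1$. The covering system method: if $n\equiv r_j\pmod{m_j}$ and $K\equiv -2^{ -r_j}\pmod{p_j}$ then $p_j\mid K\cdot 2^n+1$ (Sierpiński case), and if $K\equiv 2^{ -r_j}\pmod{p_j}$ then $p_j\mid K\cdot2^n-1$ (Riesel case). -}

module Defs where

open import Data.Nat as ℕ using (ℕ; zero; suc; _∸_; _^_)
open import Data.Nat.DivMod as ℕD using ()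
open import Data.Nat.Logarithm using (⌊log₂_⌋)
open import Data.Integer as ℤ using (ℤ; +_; _-_)
open import Data.Integer.Divisibility using (_∣_)

-- natural-number quotient (used only for exact divisions below)
_quot_ : ℕ → ℕ → ℕ
a quot zero = zero
a quot (suc b) = a ℕD./ suc b

ℓ : ℕ → ℕ
ℓ k = ⌊log₂ k ⌋ ℕ.+ 1

-- the 2-repstring k_2^{(z;t)} = k (2^{(z+ℓ)t} - 1) / (2^{z+ℓ} - 1)
repstring : (k z t : ℕ) → ℕ
repstring k z t =
  k ℕ.* ((2 ^ ((z ℕ.+ ℓ k) ℕ.* t) ∸ 1) quot (2 ^ (z ℕ.+ ℓ k) ∸ 1))

infix 4 _≡_[mod_]
_≡_[mod_] : ℤ → ℤ → ℤ → Set
a ≡ b [mod m ] = m ∣ (a - b)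

open import Data.Product using (Σ; _×_; ∃-syntax)
open import Data.List using (List; map)
open import Data.List.Relation.Unary.All using (All)
open import Data.List.Relation.Unary.Any using (Any)
open import Data.List.Relation.Unary.Unique.Propositional using (Unique)
open import Data.Nat.Primality using (Prime)
import Data.Nat.Divisibility as ℕDiv

Inv2Pow : ℕ → ℕ → ℤ → Set
Inv2Pow r p x = x ℤ.* (+ (2 ^ r)) ≡ + 1 [mod + p ]

infix 4 _≡-2^-_[mod_]
_≡-2^-_[mod_] : ℤ → ℕ → ℕ → Set
K ≡-2^- r [mod p ] = ∃[ x ] (Inv2Pow r p x × K ≡ ℤ.- x [mod + p ])

infix 4 _≡2^-_[mod_]
_≡2^-_[mod_] : ℤ → ℕ → ℕ → Set
K ≡2^- r [mod p ] = ∃[ x ] (Inv2Pow r p x × K ≡ x [mod + p ])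

-- one congruence r (mod m) of the system, with its attached prime p
record CovEntry : Set where
  constructor entry
  field
    r : ℕ
    m : ℕ
    p : ℕ
open CovEntry public

IsCovering : List CovEntry → Set
IsCovering cs =
  All (λ c → 1 ℕ.≤ m c) cs ×
  ((n : ℤ) → Any (λ c → n ≡ + r c [mod + m c ]) cs)

IsCoveringWithPrimes : List CovEntry → Set
IsCoveringWithPrimes cs =
  IsCovering cs ×
  All (λ c → Prime (p c) × (p c ℕDiv.∣ (2 ^ m c ∸ 1))) cs ×
  Unique (map p cs)

{-# OPTIONS --safe #-}
module Submission where

-- Write R t = k_2^{(z;t)} and L = z + ℓ. Concatenating blocks of L bits gives
-- R (a + b) = R a + 2^{L a} R b. So if R agrees modulo p at a and at a + (a + b), then
-- 2^{L a} R (a + b) ≡ 0, hence R (a + b) ≡ 0 because 2 is invertible modulo p ∣ 2^m - 1,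
-- i.e. 2^{L a} R b ≡ - R a (mod p). Now fix a ≥ 1 in the class c mod w: for every b in the
-- class -c, also a + (a + b) lies in c, so R a ≡ ∓2^{-r} (mod p) at both points forces
-- R b ≡ ±2^{-(r + L a)} (mod p). Shifting every residue of the covering by L a thus turns
-- a Sierpiński covering for the class c into a Riesel covering for -c, and conversely.

open import Defs
open import Data.Integer as ℤ using (ℤ; +_; -_)
open import Data.Integer.Divisibility.Signed as Signed
  using (∣ᵤ⇒∣; ∣⇒∣ᵤ; ∣-refl; ∣m∣n⇒∣m+n; ∣m∣n⇒∣m-n; ∣m⇒∣-m; ∣n⇒∣m*n; ∣m⇒∣m*n)
import Data.Integer.Properties as ℤₚ
open import Algebra.Properties.CommutativeSemigroup ℤₚ.*-commutativeSemigroup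
  using (x∙yz≈y∙xz; x∙yz≈zx∙y; x∙yz≈y∙zx)
open import Data.Integer.Tactic.RingSolver using (solve)
open import Data.List.Base using (map; _∷_; [])
open import Data.List.Properties using (map-∘)
open import Data.List.Relation.Unary.All as All using (All)
import Data.List.Relation.Unary.All.Properties as AllP
import Data.List.Relation.Unary.Any as Any
import Data.List.Relation.Unary.Any.Properties as AnyP
open import Data.List.Relation.Unary.Unique.Propositional using (Unique)
open import Data.Nat using (ℕ; zero; suc; _≤_; _^_; _∸_; s≤s; z≤n)
import Data.Nat as ℕ
open import Data.Nat.Divisibility using (_∣_)
open import Data.Nat.DivMod using (_/_; m*n/n≡m)
open import Data.Nat.Logarithm using (⌊log₂_⌋)
import Data.Nat.Properties as ℕₚ
open import Data.Nat.Tactic.RingSolver using (solve-∀)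
open import Data.Product using (∃-syntax; _×_; _,_; proj₂)
open import Function.Bundles using (_⇔_; mk⇔)
open import Level using (0ℓ)
open import Relation.Binary.Bundles using (Setoid)
open import Relation.Binary.PropositionalEquality
  using (_≡_; refl; sym; trans; cong; cong₂; subst; module ≡-Reasoning)
import Relation.Binary.Reasoning.Setoid as SetoidReasoning

module _ where
  open import Data.Nat using (_+_; _*_)
  open ≡-Reasoning

  geometricSum : ℕ → ℕ → ℕ
  geometricSum N zero    = 0
  geometricSum N (suc t) = 1 + N * geometricSum N t

  ^-geometricSum : ∀ d t → suc d ^ t ≡ 1 + geometricSum (suc d) t * d
  ^-geometricSum d zero    = refl
  ^-geometricSum d (suc t) = begin
    suc d * suc d ^ t          ≡⟨ cong (suc d *_) (^-geometricSum d t) ⟩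
    suc d * (1 + G * d)        ≡⟨ rearrange d G ⟩
    1 + (1 + suc d * G) * d    ∎
    where
    G : ℕ
    G = geometricSum (suc d) t
    rearrange : ∀ d g → suc d * (1 + g * d) ≡ 1 + (1 + suc d * g) * d
    rearrange = solve-∀

  geometricSum-+ : ∀ N a b → geometricSum N (a + b) ≡ geometricSum N a + N ^ a * geometricSum N b
  geometricSum-+ N zero    b = sym (ℕₚ.+-identityʳ (geometricSum N b))
  geometricSum-+ N (suc a) b = begin
    1 + N * G (a + b)             ≡⟨ cong (λ g → 1 + N * g) (geometricSum-+ N a b) ⟩
    1 + N * (G a + N ^ a * G b)   ≡⟨ rearrange N (G a) (N ^ a) (G b) ⟩
    1 + N * G a + N * N ^ a * G b ∎
    where
    G : ℕ → ℕ
    G = geometricSum N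
    rearrange : ∀ N g n h → 1 + N * (g + n * h) ≡ 1 + N * g + N * n * h
    rearrange = solve-∀

  geometricSum-quot : ∀ {N} t → 2 ≤ N → (N ^ t ∸ 1) quot (N ∸ 1) ≡ geometricSum N t
  geometricSum-quot {suc (suc d)} t (s≤s (s≤s _)) = begin
    (suc (suc d) ^ t ∸ 1) / suc d ≡⟨ cong (λ n → (n ∸ 1) / suc d) (^-geometricSum (suc d) t) ⟩
    G * suc d / suc d             ≡⟨ m*n/n≡m G (suc d) ⟩
    G                             ∎
    where
    G : ℕ
    G = geometricSum (suc (suc d)) t

  blockLength : ℕ → ℕ → ℕ
  blockLength k z = z + ℓ k

  2≤2^blockLength : ∀ k z → 2 ≤ 2 ^ blockLength k z
  2≤2^blockLength k z = ℕₚ.^-monoʳ-≤ 2 (ℕₚ.≤-trans (ℕₚ.m≤n+m 1 ⌊log₂ k ⌋) (ℕₚ.m≤n+m (ℓ k) z))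

  repstring≡k*geometricSum : ∀ k z t → repstring k z t ≡ k * geometricSum (2 ^ blockLength k z) t
  repstring≡k*geometricSum k z t = cong (k *_) (begin
    (2 ^ (L * t) ∸ 1) quot (2 ^ L ∸ 1)   ≡⟨ cong (λ n → (n ∸ 1) quot (2 ^ L ∸ 1)) (ℕₚ.^-*-assoc 2 L t) ⟨
    ((2 ^ L) ^ t ∸ 1) quot (2 ^ L ∸ 1)   ≡⟨ geometricSum-quot t (2≤2^blockLength k z) ⟩
    geometricSum (2 ^ L) t               ∎)
    where
    L : ℕ
    L = blockLength k z

  repstring-+ : ∀ k z a b →
    repstring k z (a + b) ≡ repstring k z a + 2 ^ (blockLength k z * a) * repstring k z b
  repstring-+ k z a b = begin
    R (a + b)                   ≡⟨ R≡k*G (a + b) ⟩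
    k * G (a + b)               ≡⟨ cong (k *_) (geometricSum-+ N a b) ⟩
    k * (G a + N ^ a * G b)     ≡⟨ rearrange k (G a) (N ^ a) (G b) ⟩
    k * G a + N ^ a * (k * G b) ≡⟨ cong₂ _+_ (R≡k*G a) (cong₂ _*_ (sym (ℕₚ.^-*-assoc 2 L a)) (R≡k*G b)) ⟨
    R a + 2 ^ (L * a) * R b     ∎
    where
    L N : ℕ
    L = blockLength k z
    N = 2 ^ L
    G R : ℕ → ℕ
    G = geometricSum N
    R = repstring k z
    R≡k*G : ∀ t → R t ≡ k * G t
    R≡k*G = repstring≡k*geometricSum k z
    rearrange : ∀ k g n h → k * (g + n * h) ≡ k * g + n * (k * h)
    rearrange = solve-∀

open import Data.Integer using (_+_; _*_; _-_)

module Modulo (m : ℤ) where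

  -- A record rather than the bare congruence of Defs, so that unification can recover both
  -- sides (the underlying divisibility only mentions their difference).
  infix 4 _≈_
  record _≈_ (a b : ℤ) : Set where
    constructor ≡-mod⇒≈
    field ≈⇒≡-mod : a ≡ b [mod m ]
  open _≈_ public

  private
    by-difference : ∀ {a b} c → a - b ≡ c → m Signed.∣ c → a ≈ b
    by-difference c a-b≡c m∣c = ≡-mod⇒≈ (∣⇒∣ᵤ (subst (Signed._∣_ m) (sym a-b≡c) m∣c))

    ∣-difference : ∀ {a b} → a ≈ b → m Signed.∣ a - b
    ∣-difference (≡-mod⇒≈ a≡b) = ∣ᵤ⇒∣ a≡b

  ≈-reflexive : ∀ {a b} → a ≡ b → a ≈ b
  ≈-reflexive {a} refl = by-difference (m * + 0) (solve (a ∷ m ∷ [])) (∣m⇒∣m*n (+ 0) ∣-refl)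

  ≈-refl : ∀ {a} → a ≈ a
  ≈-refl = ≈-reflexive refl

  ≈-sym : ∀ {a b} → a ≈ b → b ≈ a
  ≈-sym {a} {b} a≈b = by-difference (- (a - b)) (solve (a ∷ b ∷ [])) (∣m⇒∣-m (∣-difference a≈b))

  ≈-trans : ∀ {a b c} → a ≈ b → b ≈ c → a ≈ c
  ≈-trans {a} {b} {c} a≈b b≈c = by-difference ((a - b) + (b - c)) (solve (a ∷ b ∷ c ∷ []))
    (∣m∣n⇒∣m+n (∣-difference a≈b) (∣-difference b≈c))

  ≈-setoid : Setoid 0ℓ 0ℓ
  ≈-setoid = record
    { Carrier       = ℤ
    ; _≈_           = _≈_
    ; isEquivalence = record { refl = ≈-refl ; sym = ≈-sym ; trans = ≈-trans }
    }

  open SetoidReasoning ≈-setoid public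

  +-cong : ∀ {a b c d} → a ≈ b → c ≈ d → a + c ≈ b + d
  +-cong {a} {b} {c} {d} a≈b c≈d = by-difference ((a - b) + (c - d)) (solve (a ∷ b ∷ c ∷ d ∷ []))
    (∣m∣n⇒∣m+n (∣-difference a≈b) (∣-difference c≈d))

  *-cong : ∀ {a b c d} → a ≈ b → c ≈ d → a * c ≈ b * d
  *-cong {a} {b} {c} {d} a≈b c≈d = by-difference (a * (c - d) + (a - b) * d) (solve (a ∷ b ∷ c ∷ d ∷ []))
    (∣m∣n⇒∣m+n (∣n⇒∣m*n a (∣-difference c≈d)) (∣m⇒∣m*n d (∣-difference a≈b)))

  -‿cong : ∀ {a b} → a ≈ b → - a ≈ - b
  -‿cong {a} {b} a≈b = by-difference (- (a - b)) (solve (a ∷ b ∷ [])) (∣m⇒∣-m (∣-difference a≈b))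

  a+b≈a⇒b≈0 : ∀ a {b} → a + b ≈ a → b ≈ + 0
  a+b≈a⇒b≈0 a {b} a+b≈a = by-difference ((a + b) - a) (solve (a ∷ b ∷ [])) (∣-difference a+b≈a)

  a+b≈0⇒b≈-a : ∀ a {b} → a + b ≈ + 0 → b ≈ - a
  a+b≈0⇒b≈-a a {b} a+b≈0 = by-difference ((a + b) - + 0) (solve (a ∷ b ∷ [])) (∣-difference a+b≈0)

  a-b≈c⇒a≈c+b : ∀ {a} b {c} → a - b ≈ c → a ≈ c + b
  a-b≈c⇒a≈c+b {a} b {c} a-b≈c = by-difference ((a - b) - c) (solve (a ∷ b ∷ c ∷ [])) (∣-difference a-b≈c)

  multiple≈0 : ∀ q → q * m ≈ + 0
  multiple≈0 q = by-difference (q * m) (solve (q ∷ m ∷ [])) (∣n⇒∣m*n q ∣-refl)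

  unit*a≈0⇒a≈0 : ∀ {u} v {a} → v * u ≈ + 1 → u * a ≈ + 0 → a ≈ + 0
  unit*a≈0⇒a≈0 {u} v {a} vu≈1 ua≈0 =
    by-difference (v * (u * a - + 0) - (v * u - + 1) * a) (solve (u ∷ v ∷ a ∷ []))
      (∣m∣n⇒∣m-n (∣n⇒∣m*n v (∣-difference ua≈0)) (∣m⇒∣m*n a (∣-difference vu≈1)))

module _ {p : ℕ} where
  open Modulo (+ p)

  ∣∸⇒≈ : ∀ {a b} → b ≤ a → p ∣ a ∸ b → + a ≈ + b
  ∣∸⇒≈ {a} {b} b≤a p∣a∸b = ≡-mod⇒≈ (subst (λ d → p ∣ ℤ.∣ d ∣) (sym +a-+b≡+[a∸b]) p∣a∸b)
    where
    +a-+b≡+[a∸b] : + a - + b ≡ + (a ∸ b)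
    +a-+b≡+[a∸b] = trans (ℤₚ.m-n≡m⊖n a b) (ℤₚ.⊖-≥ b≤a)

  Inv2Pow-unique : ∀ r {x y} → Inv2Pow r p x → Inv2Pow r p y → x ≈ y
  Inv2Pow-unique r {x} {y} x⁻¹ y⁻¹ = begin
    x             ≡⟨ ℤₚ.*-identityʳ x ⟨
    x * + 1       ≈⟨ *-cong (≈-refl {x}) (≈-sym (≡-mod⇒≈ y⁻¹)) ⟩
    x * (y * e)   ≡⟨ x∙yz≈y∙xz x y e ⟩
    y * (x * e)   ≈⟨ *-cong (≈-refl {y}) (≡-mod⇒≈ x⁻¹) ⟩
    y * + 1       ≡⟨ ℤₚ.*-identityʳ y ⟩
    y             ∎
    where
    e : ℤ
    e = + (2 ^ r)

  Inv2Pow-shift : ∀ r s y {x} → Inv2Pow r p x → + (2 ^ s) * y ≈ x → Inv2Pow (r ℕ.+ s) p y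
  Inv2Pow-shift r s y {x} x⁻¹ 2^s*y≈x = ≈⇒≡-mod (begin
    y * + (2 ^ (r ℕ.+ s))   ≡⟨ cong (λ n → y * + n) (ℕₚ.^-distribˡ-+-* 2 r s) ⟩
    y * + (2 ^ r ℕ.* 2 ^ s) ≡⟨ cong (y *_) (ℤₚ.pos-* (2 ^ r) (2 ^ s)) ⟩
    y * (e * + (2 ^ s))     ≡⟨ x∙yz≈zx∙y y e (+ (2 ^ s)) ⟩
    + (2 ^ s) * y * e       ≈⟨ *-cong 2^s*y≈x (≈-refl {e}) ⟩
    x * e                   ≈⟨ ≡-mod⇒≈ x⁻¹ ⟩
    + 1                     ∎)
    where
    e : ℤ
    e = + (2 ^ r)

  2^-invertible : ∀ {m} → 1 ≤ m → p ∣ 2 ^ m ∸ 1 → ∀ r → ∃[ x ] Inv2Pow r p x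
  2^-invertible _ _ zero = + 1 , ≈⇒≡-mod (≈-refl {+ 1})
  2^-invertible {suc m} 1≤m p∣2^m-1 (suc r) with 2^-invertible 1≤m p∣2^m-1 r
  ... | x , x⁻¹ = v * x , Inv2Pow-shift 1 r (v * x) v⁻¹ (begin
    e * (v * x)   ≡⟨ x∙yz≈y∙zx e v x ⟩
    v * (x * e)   ≈⟨ *-cong (≈-refl {v}) (≡-mod⇒≈ x⁻¹) ⟩
    v * + 1       ≡⟨ ℤₚ.*-identityʳ v ⟩
    v             ∎)
    where
    e v : ℤ
    e = + (2 ^ r)
    v = + (2 ^ m)
    v⁻¹ : Inv2Pow 1 p v
    v⁻¹ = ≈⇒≡-mod (begin
      v * + 2             ≡⟨ ℤₚ.pos-* (2 ^ m) 2 ⟨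
      + (2 ^ m ℕ.* 2)     ≡⟨ cong +_ (ℕₚ.*-comm (2 ^ m) 2) ⟩
      + (2 ^ suc m)       ≈⟨ ∣∸⇒≈ (ℕₚ.m^n>0 2 (suc m)) p∣2^m-1 ⟩
      + 1                 ∎)

  repstring-reflect : ∀ k z a b {m} → 1 ≤ m → p ∣ 2 ^ m ∸ 1 →
    + repstring k z (a ℕ.+ (a ℕ.+ b)) ≈ + repstring k z a →
    + (2 ^ (blockLength k z ℕ.* a)) * + repstring k z b ≈ - + repstring k z a
  repstring-reflect k z a b 1≤m p∣2^m-1 R[2a+b]≈Ra = a+b≈0⇒b≈-a (R a) (begin
    R a + u * R b      ≡⟨ R-+ a b ⟨
    R (a ℕ.+ b)        ≈⟨ R[a+b]≈0 ⟩
    + 0                ∎)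
    where
    R : ℕ → ℤ
    R t = + repstring k z t
    u : ℤ
    u = + (2 ^ (blockLength k z ℕ.* a))
    R-+ : ∀ s t → R (s ℕ.+ t) ≡ R s + + (2 ^ (blockLength k z ℕ.* s)) * R t
    R-+ s t = trans (cong +_ (repstring-+ k z s t))
      (trans (ℤₚ.pos-+ (repstring k z s) _) (cong (λ n → R s + n) (ℤₚ.pos-* (2 ^ (blockLength k z ℕ.* s)) _)))
    R[a+b]≈0 : R (a ℕ.+ b) ≈ + 0
    R[a+b]≈0 with 2^-invertible 1≤m p∣2^m-1 (blockLength k z ℕ.* a)
    ... | v , v⁻¹ = unit*a≈0⇒a≈0 v (≡-mod⇒≈ v⁻¹) (a+b≈a⇒b≈0 (R a) (begin
      R a + u * R (a ℕ.+ b)   ≡⟨ R-+ a (a ℕ.+ b) ⟨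
      R (a ℕ.+ (a ℕ.+ b))     ≈⟨ R[2a+b]≈Ra ⟩
      R a                     ∎))

  sierpinski⇒riesel-entry : ∀ k z a b r {m} → 1 ≤ m → p ∣ 2 ^ m ∸ 1 →
    + repstring k z a ≡-2^- r [mod p ] →
    + repstring k z (a ℕ.+ (a ℕ.+ b)) ≡-2^- r [mod p ] →
    + repstring k z b ≡2^- r ℕ.+ blockLength k z ℕ.* a [mod p ]
  sierpinski⇒riesel-entry k z a b r 1≤m p∣2^m-1 (x , x⁻¹ , Ra≡-x) (y , y⁻¹ , R[2a+b]≡-y) =
    R b , Inv2Pow-shift r (blockLength k z ℕ.* a) (R b) x⁻¹ u*Rb≈x , ≈⇒≡-mod (≈-refl {R b})
    where
    R : ℕ → ℤ
    R t = + repstring k z t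
    u*Rb≈x : + (2 ^ (blockLength k z ℕ.* a)) * R b ≈ x
    u*Rb≈x = begin
      + (2 ^ (blockLength k z ℕ.* a)) * R b ≈⟨ repstring-reflect k z a b 1≤m p∣2^m-1 (begin
        R (a ℕ.+ (a ℕ.+ b))                   ≈⟨ ≡-mod⇒≈ R[2a+b]≡-y ⟩
        - y                                   ≈⟨ -‿cong (Inv2Pow-unique r {y} {x} y⁻¹ x⁻¹) ⟩
        - x                                   ≈⟨ ≈-sym (≡-mod⇒≈ Ra≡-x) ⟩
        R a                                   ∎) ⟩
      - R a                                   ≈⟨ -‿cong (≡-mod⇒≈ Ra≡-x) ⟩
      - - x                                   ≡⟨ ℤₚ.neg-involutive x ⟩
      x                                       ∎

  riesel⇒sierpinski-entry : ∀ k z a b r {m} → 1 ≤ m → p ∣ 2 ^ m ∸ 1 →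
    + repstring k z a ≡2^- r [mod p ] →
    + repstring k z (a ℕ.+ (a ℕ.+ b)) ≡2^- r [mod p ] →
    + repstring k z b ≡-2^- r ℕ.+ blockLength k z ℕ.* a [mod p ]
  riesel⇒sierpinski-entry k z a b r 1≤m p∣2^m-1 (x , x⁻¹ , Ra≡x) (y , y⁻¹ , R[2a+b]≡y) =
    - R b , Inv2Pow-shift r (blockLength k z ℕ.* a) (- R b) x⁻¹ u*[-Rb]≈x ,
    ≈⇒≡-mod (≈-reflexive (sym (ℤₚ.neg-involutive (R b))))
    where
    R : ℕ → ℤ
    R t = + repstring k z t
    u : ℤ
    u = + (2 ^ (blockLength k z ℕ.* a))
    u*[-Rb]≈x : u * - R b ≈ x
    u*[-Rb]≈x = begin
      u * - R b           ≡⟨ ℤₚ.neg-distribʳ-* u (R b) ⟨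
      - (u * R b)         ≈⟨ -‿cong (repstring-reflect k z a b 1≤m p∣2^m-1 (begin
        R (a ℕ.+ (a ℕ.+ b)) ≈⟨ ≡-mod⇒≈ R[2a+b]≡y ⟩
        y                   ≈⟨ Inv2Pow-unique r y⁻¹ x⁻¹ ⟩
        x                   ≈⟨ ≈-sym (≡-mod⇒≈ Ra≡x) ⟩
        R a                 ∎)) ⟩
      - - R a             ≡⟨ ℤₚ.neg-involutive (R a) ⟩
      R a                 ≈⟨ ≡-mod⇒≈ Ra≡x ⟩
      x                   ∎

module _ {w : ℕ} where
  open Modulo (+ w)

  a+[a+b]≈c : ∀ a b c → + a ≈ c → + b ≈ - c → + (a ℕ.+ (a ℕ.+ b)) ≈ c
  a+[a+b]≈c a b c a≈c b≈-c = begin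
    + (a ℕ.+ (a ℕ.+ b))   ≡⟨ trans (ℤₚ.pos-+ a (a ℕ.+ b)) (cong (λ n → + a + n) (ℤₚ.pos-+ a b)) ⟩
    + a + (+ a + + b)     ≈⟨ +-cong a≈c (+-cong a≈c b≈-c) ⟩
    c + (c + - c)         ≡⟨ cong (λ n → c + n) (ℤₚ.+-inverseʳ c) ⟩
    c + + 0               ≡⟨ ℤₚ.+-identityʳ c ⟩
    c                     ∎

∃-positive-≡-neg : ∀ {w} → 1 ≤ w → ∀ n → ∃[ a ] (1 ≤ a × + a ≡ - + n [mod + w ])
∃-positive-≡-neg {suc w′} _ n = suc w′ ℕ.+ n ℕ.* w′ , s≤s z≤n , ≈⇒≡-mod (a+b≈0⇒b≈-a (+ n) {+ a} (begin
  + n + + a                ≡⟨ ℤₚ.pos-+ n a ⟨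
  + (n ℕ.+ a)              ≡⟨ cong +_ (arithmetic n w′) ⟩
  + (suc n ℕ.* suc w′)     ≡⟨ ℤₚ.pos-* (suc n) (suc w′) ⟩
  + suc n * + suc w′       ≈⟨ multiple≈0 (+ suc n) ⟩
  + 0                      ∎))
  where
  open Modulo (+ suc w′)
  a : ℕ
  a = suc w′ ℕ.+ n ℕ.* w′
  arithmetic : ∀ n w′ → n ℕ.+ (suc w′ ℕ.+ n ℕ.* w′) ≡ suc n ℕ.* suc w′
  arithmetic = solve-∀

shift : ℕ → CovEntry → CovEntry
shift K e = entry (r e ℕ.+ K) (m e) (p e)

shift-IsCoveringWithPrimes : ∀ K {cs} → IsCoveringWithPrimes cs → IsCoveringWithPrimes (map (shift K) cs)
shift-IsCoveringWithPrimes K {cs} ((1≤ms , covers) , primes , distinct) =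
  (AllP.map⁺ 1≤ms , λ n → AnyP.map⁺ (Any.map (λ {e} → shifted n e) (covers (n - + K)))) ,
  AllP.map⁺ primes ,
  subst Unique (map-∘ cs) distinct
  where
  shifted : ∀ n e → n - + K ≡ + r e [mod + m e ] → n ≡ + (r e ℕ.+ K) [mod + m e ]
  shifted n e n-K≡r = ≈⇒≡-mod (begin
    n            ≈⟨ a-b≈c⇒a≈c+b (+ K) {+ r e} (≡-mod⇒≈ n-K≡r) ⟩
    + r e + + K  ≡⟨ ℤₚ.pos-+ (r e) K ⟨
    + (r e ℕ.+ K) ∎)
    where open Modulo (+ m e)

All-map-shift : ∀ {P Q S : CovEntry → Set} K {cs} → IsCoveringWithPrimes cs →
  (∀ {e} → 1 ≤ m e → p e ∣ 2 ^ m e ∸ 1 → P e → Q e → S (shift K e)) →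
  All P cs → All Q cs → All S (map (shift K) cs)
All-map-shift K ((1≤ms , _) , primes , _) f Ps Qs = AllP.map⁺ (All.tabulate λ e∈cs →
  f (All.lookup 1≤ms e∈cs) (proj₂ (All.lookup primes e∈cs)) (All.lookup Ps e∈cs) (All.lookup Qs e∈cs))

SierpinskiCovering : (k z w : ℕ) → ℤ → Set
SierpinskiCovering k z w c = ∃[ cs ] (IsCoveringWithPrimes cs ×
  ((t : ℕ) → 1 ≤ t → + t ≡ c [mod + w ] → All (λ e → + repstring k z t ≡-2^- r e [mod p e ]) cs))

RieselCovering : (k z w : ℕ) → ℤ → Set
RieselCovering k z w c = ∃[ cs ] (IsCoveringWithPrimes cs ×
  ((t : ℕ) → 1 ≤ t → + t ≡ c [mod + w ] → All (λ e → + repstring k z t ≡2^- r e [mod p e ]) cs))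

sierpinski⇒riesel : ∀ k z {w} c → ∃[ a ] (1 ≤ a × + a ≡ c [mod + w ]) →
  SierpinskiCovering k z w c → RieselCovering k z w (- c)
sierpinski⇒riesel k z {w} c (a , 1≤a , a≡c) (cs , cov , sierpinski) =
  map (shift K) cs , shift-IsCoveringWithPrimes K cov , λ b _ b≡-c →
    All-map-shift K cov (λ {e} → sierpinski⇒riesel-entry k z a b (r e))
      (sierpinski a 1≤a a≡c)
      (sierpinski (a ℕ.+ (a ℕ.+ b)) (ℕₚ.≤-trans 1≤a (ℕₚ.m≤m+n a _))
        (≈⇒≡-mod (a+[a+b]≈c a b c (≡-mod⇒≈ a≡c) (≡-mod⇒≈ b≡-c))))
  where
  open Modulo (+ w)
  K : ℕ
  K = blockLength k z ℕ.* a

riesel⇒sierpinski : ∀ k z {w} c → ∃[ a ] (1 ≤ a × + a ≡ - c [mod + w ]) →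
  RieselCovering k z w (- c) → SierpinskiCovering k z w c
riesel⇒sierpinski k z {w} c (a , 1≤a , a≡-c) (cs , cov , riesel) =
  map (shift K) cs , shift-IsCoveringWithPrimes K cov , λ b _ b≡c →
    All-map-shift K cov (λ {e} → riesel⇒sierpinski-entry k z a b (r e))
      (riesel a 1≤a a≡-c)
      (riesel (a ℕ.+ (a ℕ.+ b)) (ℕₚ.≤-trans 1≤a (ℕₚ.m≤m+n a _))
        (≈⇒≡-mod (a+[a+b]≈c a b (- c) (≡-mod⇒≈ a≡-c) (b≈--c (≡-mod⇒≈ b≡c)))))
  where
  open Modulo (+ w)
  K : ℕ
  K = blockLength k z ℕ.* a
  b≈--c : ∀ {b} → + b ≈ c → + b ≈ - - c
  b≈--c b≈c = ≈-trans b≈c (≈-reflexive (sym (ℤₚ.neg-involutive c)))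

theorem4p6 : (k 𝔱 w z : ℕ) → 1 ≤ k → 1 ≤ 𝔱 → 1 ≤ w →
    (∃[ cs ] (IsCoveringWithPrimes cs ×
        ((t : ℕ) → 1 ≤ t → + t ≡ + 𝔱 [mod + w ] →
          All (λ c → + (repstring k z t) ≡-2^- r c [mod p c ]) cs)))
    ⇔
    (∃[ cs′ ] (IsCoveringWithPrimes cs′ ×
        ((t′ : ℕ) → 1 ≤ t′ → + t′ ≡ - (+ 𝔱) [mod + w ] →
          All (λ c → + (repstring k z t′) ≡2^- r c [mod p c ]) cs′)))
theorem4p6 k 𝔱 w z _ 1≤𝔱 1≤w = mk⇔
  (sierpinski⇒riesel k z (+ 𝔱) (𝔱 , 1≤𝔱 , ≈⇒≡-mod (≈-refl {+ 𝔱})))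
  (riesel⇒sierpinski k z (+ 𝔱) (∃-positive-≡-neg 1≤w 𝔱))
  where open Modulo (+ w) using (≈-refl; ≈⇒≡-mod)
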